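{- Let $G=(V,E)$ be a graph and let $p\in\mathcal{P}(G)$. Let $X$ be the set of all pairs $(r,\varepsilon)$, with $r$ a reset vector and $\varepsilon\in(0,1)$, such that $p=\mathrm{PR}(G,r,\varepsilon)$. If $pM=p$, then $X=\{(p,\varepsilon):\varepsilon\in(0,1)\}$; otherwise $X=\{(\mathcal{R}^{ -1}(G,p,\varepsilon),\varepsilon):\varepsilon\in(0,1),\ \mathcal{R}^{ -1}(G,p,\varepsilon)\ge \mathbf{0}\}$.
   Context: Graphs are finite directed graphs; vertices with no out-edges carry a self-loop; $N_{in}(v)$ is the set of in-neighbours and $d_{out}(w)$ the out-degree. $M$ is the matrix with $M[u,v]=1/d_{out}(u)$ if $(u,v)\in E$ and $0$ otherwise; vectors are row vectors. A ranking (reset) vector is $x:V\to[0,1]$ with $\sum_v x[v]=1$. $\mathrm{PR}(G,r,\varepsilon)$ is the unique stationary distribution of the chain with transition matrix $(1-\varepsilon)M+\varepsilon R$, $R[u,v]=r[v]$. $\mathcal{P}(G)=\{\mathrm{PR}(G,r,\varepsilon): r \text{ a ranking vector},\ \varepsilon\in(0,1)\}$. For a ranking vector $p$ and $\varepsilon\in(0,1)$, $\mathcal{R}^{ -1}(G,p,\varepsilon)[v]=\frac{p[v]}{\varepsilon}-\frac{1-\varepsilon}{\varepsilon}\sum_{w\in N_{in}(v)}\frac{p[w]}{d_{out}(w)}$. -}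

module Defs where

open import Level using (Level; _⊔_)
open import Data.Nat as ℕ using (ℕ)
open import Data.Fin using (Fin)
open import Data.Bool using (Bool; true; false; if_then_else_)
open import Data.Product using (_×_; Σ; ∃; _,_)
open import Relation.Binary.PropositionalEquality using (_≡_; _≢_)
open import Relation.Binary.Structures using (IsTotalOrder)
open import Algebra.Structures using (IsCommutativeRing)
open import Function.Bundles using (_⇔_)
open import Relation.Nullary using (¬_)

-- An ordered field (the paper works over ℝ; we state the result for an
-- arbitrary ordered field, ℝ being an instance).  The inverse is total, with 0⁻¹ unspecified.

record OrderedField (c ℓ : Level) : Set (Level.suc (c ⊔ ℓ)) where
  infixl 6 _+_ _-_
  infixl 7 _*_
  infix 4 _≤_ _<_
  field
    Carrier : Set c
    _+_ _*_ : Carrier → Carrier → Carrier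
    -_ _⁻¹  : Carrier → Carrier
    0# 1#   : Carrier
    _≤_     : Carrier → Carrier → Set ℓ
    isCommutativeRing : IsCommutativeRing _≡_ _+_ _*_ -_ 0# 1#
    0≢1      : 0# ≢ 1#
    ⁻¹-inverse : ∀ x → x ≢ 0# → x * (x ⁻¹) ≡ 1#
    isTotalOrder : IsTotalOrder _≡_ _≤_
    +-mono-≤ : ∀ {x y} z → x ≤ y → x + z ≤ y + z
    *-nonneg : ∀ {x y} → 0# ≤ x → 0# ≤ y → 0# ≤ x * y

  _-_ : Carrier → Carrier → Carrier
  x - y = x + (- y)

  _<_ : Carrier → Carrier → Set (c ⊔ ℓ)
  x < y = (x ≤ y) × (x ≢ y)

  fromℕ : ℕ → Carrier
  fromℕ ℕ.zero    = 0#
  fromℕ (ℕ.suc k) = 1# + fromℕ k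

Graph : ℕ → Set
Graph n = Fin n → Fin n → Bool

sumℕ : ∀ {n} → (Fin n → ℕ) → ℕ
sumℕ {ℕ.zero}  f = 0
sumℕ {ℕ.suc n} f = f Fin.zero ℕ.+ sumℕ (λ i → f (Fin.suc i))

outDeg : ∀ {n} → Graph n → Fin n → ℕ
outDeg E u = sumℕ (λ v → if E u v then 1 else 0)

-- standing assumption: vertices with no out-edges carry a self-loop,
-- i.e. every vertex has at least one out-edge
NoDangling : ∀ {n} → Graph n → Set
NoDangling {n} E = ∀ (u : Fin n) → ∃ λ v → E u v ≡ true

module WithField {c ℓ : Level} (F : OrderedField c ℓ) where
  open OrderedField F

  Σ[_] : ∀ {n} → (Fin n → Carrier) → Carrier
  Σ[_] {ℕ.zero}  f = 0#
  Σ[_] {ℕ.suc n} f = f Fin.zero + Σ[ (λ i → f (Fin.suc i)) ]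

  Vector : ℕ → Set c
  Vector n = Fin n → Carrier

  _≐_ : ∀ {n} → Vector n → Vector n → Set c
  x ≐ y = ∀ v → x v ≡ y v

  M : ∀ {n} → Graph n → Fin n → Fin n → Carrier
  M E u v = if E u v then (fromℕ (outDeg E u)) ⁻¹ else 0#

  _·_ : ∀ {n} → Vector n → (Fin n → Fin n → Carrier) → Vector n
  (x · A) v = Σ[ (λ u → x u * A u v) ]

  RankingVector : ∀ {n} → Vector n → Set (c ⊔ ℓ)
  RankingVector x = (∀ v → (0# ≤ x v) × (x v ≤ 1#)) × (Σ[ x ] ≡ 1#)

  InUnit : Carrier → Set (c ⊔ ℓ)
  InUnit ε = (0# < ε) × (ε < 1#)

  T : ∀ {n} → Graph n → Vector n → Carrier → Fin n → Fin n → Carrier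
  T E r ε u v = (1# - ε) * M E u v + ε * r v

  -- p = PR(G,r,ε): p is the (unique) stationary distribution of T
  IsPR : ∀ {n} → Graph n → Vector n → Carrier → Vector n → Set (c ⊔ ℓ)
  IsPR E r ε p = RankingVector p × ((p · T E r ε) ≐ p)

  InP : ∀ {n} → Graph n → Vector n → Set (c ⊔ ℓ)
  InP E p = ∃ λ r → ∃ λ ε → RankingVector r × InUnit ε × IsPR E r ε p

  InX : ∀ {n} → Graph n → Vector n → Vector n → Carrier → Set (c ⊔ ℓ)
  InX E p r ε = RankingVector r × InUnit ε × IsPR E r ε p

  inSum : ∀ {n} → Graph n → Vector n → Fin n → Carrier
  inSum E p v = Σ[ (λ w → if E w v then p w * (fromℕ (outDeg E w)) ⁻¹ else 0#) ]

  Rinv : ∀ {n} → Graph n → Vector n → Carrier → Vector n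
  Rinv E p ε v = p v * ε ⁻¹ - ((1# - ε) * ε ⁻¹) * inSum E p v

{-# OPTIONS --safe #-}
module Submission where

-- Since p sums to 1, p T = (1 - ε) p M + ε r, so p = PR(G,r,ε) is a linear
-- equation in r whose unique solution is r = 𝓡⁻¹(G,p,ε).  That solution sums
-- to 1 automatically (M is row-stochastic, so p M sums to 1 as well), hence
-- it is a reset vector exactly when it is nonnegative.  If p M = p the
-- solution is p itself for every ε, and nonnegativity is automatic.

open import Defs
open import Data.Nat using (ℕ)
open import Data.Product using (_×_)
open import Relation.Nullary using (¬_)
open import Function.Bundles using (_⇔_)

import Data.Nat as ℕ
import Data.Nat.Properties as ℕ
open import Data.Bool using (true; false; if_then_else_)
open import Data.Fin using (Fin; zero; suc)
open import Data.Product using (_,_; proj₁)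
open import Data.Sum using (inj₁; inj₂)
open import Function.Base using (_∘_)
open import Function.Bundles using (mk⇔; module Equivalence)
open import Function.Construct.Composition using (_⇔-∘_)
open import Relation.Binary.PropositionalEquality
open import Relation.Binary.Structures using (IsTotalOrder)
open import Algebra.Bundles using (CommutativeRing)
open import Algebra.Structures using (IsCommutativeRing)

f≤sumℕ : ∀ {n} (f : Fin n → ℕ) v → f v ℕ.≤ sumℕ f
f≤sumℕ f zero    = ℕ.m≤m+n _ _
f≤sumℕ f (suc v) = ℕ.≤-trans (f≤sumℕ (f ∘ suc) v) (ℕ.m≤n+m _ (f zero))

outDeg-pos : ∀ {n} {E : Graph n} → NoDangling E → ∀ u → 0 ℕ.< outDeg E u
outDeg-pos {E = E} noDangling u with noDangling u
... | v , Euv≡true =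
  ℕ.≤-trans (subst (λ b → 1 ℕ.≤ (if b then 1 else 0)) (sym Euv≡true) ℕ.≤-refl)
            (f≤sumℕ (λ w → if E u w then 1 else 0) v)

module Properties {c ℓ} (F : OrderedField c ℓ) where
  open OrderedField F
  open WithField F
  open IsCommutativeRing isCommutativeRing
    using (+-comm; +-assoc; +-identityˡ; +-identityʳ; -‿inverseˡ; -‿inverseʳ;
           distribˡ; distribʳ; *-comm; *-identityˡ; *-identityʳ; zeroʳ)
  open IsTotalOrder isTotalOrder using (antisym; total)
    renaming (refl to ≤-refl; trans to ≤-trans)

  commutativeRing : CommutativeRing c c
  commutativeRing = record { isCommutativeRing = isCommutativeRing }

  open import Algebra.Properties.Ring (CommutativeRing.ring commutativeRing)
    using (-1*x≈-x; -‿involutive; [y-z]x≈yx-zx)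
  open import Algebra.Properties.CommutativeSemigroup (CommutativeRing.*-commutativeSemigroup commutativeRing)
    using (xy∙z≈xz∙y; x∙yz≈xz∙y; x∙yz≈y∙xz)
  open import Algebra.Properties.Semiring.Sum (CommutativeRing.semiring commutativeRing)
    using (sum; sum-cong-≗; ∑-distrib-+; ∑-comm; *-distribˡ-sum; *-distribʳ-sum)

  [1-ε]x+εx≡x : ∀ ε x → (1# - ε) * x + ε * x ≡ x
  [1-ε]x+εx≡x ε x = begin
    (1# - ε) * x + ε * x  ≡⟨ distribʳ x (1# - ε) ε ⟨
    (1# - ε + ε) * x      ≡⟨ cong (_* x) (trans (+-assoc 1# (- ε) ε) (cong (1# +_) (-‿inverseˡ ε))) ⟩
    (1# + 0#) * x         ≡⟨ cong (_* x) (+-identityʳ 1#) ⟩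
    1# * x                ≡⟨ *-identityˡ x ⟩
    x                     ∎
    where open ≡-Reasoning

  +-isolateʳ : ∀ x y z → (x + y ≡ z) ⇔ (y ≡ z - x)
  +-isolateʳ x y z = mk⇔ to from
    where
    to : x + y ≡ z → y ≡ z - x
    to refl = sym (trans (cong (_- x) (+-comm x y))
                (trans (+-assoc y x (- x)) (trans (cong (y +_) (-‿inverseʳ x)) (+-identityʳ y))))
    from : y ≡ z - x → x + y ≡ z
    from refl = trans (cong (x +_) (+-comm z (- x)))
                  (trans (sym (+-assoc x (- x) z)) (trans (cong (_+ z) (-‿inverseʳ x)) (+-identityˡ z)))

  *-isolateʳ : ∀ {e i} → e * i ≡ 1# → ∀ y w → (e * y ≡ w) ⇔ (y ≡ w * i)
  *-isolateʳ {e} {i} e*i≡1 y w = mk⇔ to from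
    where
    to : e * y ≡ w → y ≡ w * i
    to refl = sym (trans (xy∙z≈xz∙y e y i) (trans (cong (_* y) e*i≡1) (*-identityˡ y)))
    from : y ≡ w * i → e * y ≡ w
    from refl = trans (x∙yz≈xz∙y e w i) (trans (cong (_* w) e*i≡1) (*-identityˡ w))

  +-*-isolateʳ : ∀ {e i} → e * i ≡ 1# → ∀ a q r p → (a * q + e * r ≡ p) ⇔ (r ≡ p * i - (a * i) * q)
  +-*-isolateʳ {e} {i} e*i≡1 a q r p =
    distribute ⇔-∘ (*-isolateʳ e*i≡1 r (p - a * q) ⇔-∘ +-isolateʳ (a * q) (e * r) p)
    where
    [p-aq]i≡pi-[ai]q : (p - a * q) * i ≡ p * i - (a * i) * q
    [p-aq]i≡pi-[ai]q = trans ([y-z]x≈yx-zx i p (a * q)) (cong (λ x → p * i - x) (xy∙z≈xz∙y a q i))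
    distribute : (r ≡ (p - a * q) * i) ⇔ (r ≡ p * i - (a * i) * q)
    distribute = mk⇔ (λ h → trans h [p-aq]i≡pi-[ai]q) (λ h → trans h (sym [p-aq]i≡pi-[ai]q))

  x≤y+x : ∀ {x y} → 0# ≤ y → x ≤ y + x
  x≤y+x {x} {y} 0≤y = subst (_≤ y + x) (+-identityˡ x) (+-mono-≤ x 0≤y)

  x≤x+y : ∀ {x y} → 0# ≤ y → x ≤ x + y
  x≤x+y {x} {y} 0≤y = subst (x ≤_) (+-comm y x) (x≤y+x 0≤y)

  +-nonneg : ∀ {x y} → 0# ≤ x → 0# ≤ y → 0# ≤ x + y
  +-nonneg 0≤x 0≤y = ≤-trans 0≤y (x≤y+x 0≤x)

  0≤1 : 0# ≤ 1#
  0≤1 with total 0# 1#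
  ... | inj₁ 0≤1 = 0≤1
  ... | inj₂ 1≤0 = subst (0# ≤_) (trans (-1*x≈-x (- 1#)) (-‿involutive 1#)) (*-nonneg 0≤-1 0≤-1)
    where
    0≤-1 : 0# ≤ - 1#
    0≤-1 = subst₂ _≤_ (-‿inverseʳ 1#) (+-identityˡ (- 1#)) (+-mono-≤ (- 1#) 1≤0)

  fromℕ-nonneg : ∀ k → 0# ≤ fromℕ k
  fromℕ-nonneg ℕ.zero    = ≤-refl
  fromℕ-nonneg (ℕ.suc k) = +-nonneg 0≤1 (fromℕ-nonneg k)

  fromℕ≢0 : ∀ {k} → 0 ℕ.< k → fromℕ k ≢ 0#
  fromℕ≢0 {ℕ.suc k} _ 1+k≡0 = 0≢1 (antisym 0≤1 (subst (1# ≤_) 1+k≡0 (x≤x+y (fromℕ-nonneg k))))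

  fromℕ-+ : ∀ j k → fromℕ (j ℕ.+ k) ≡ fromℕ j + fromℕ k
  fromℕ-+ ℕ.zero    k = sym (+-identityˡ (fromℕ k))
  fromℕ-+ (ℕ.suc j) k = trans (cong (1# +_) (fromℕ-+ j k)) (sym (+-assoc 1# (fromℕ j) (fromℕ k)))

  Σ≡sum : ∀ {n} (f : Vector n) → Σ[ f ] ≡ sum f
  Σ≡sum {ℕ.zero}  f = refl
  Σ≡sum {ℕ.suc n} f = cong (f zero +_) (Σ≡sum (f ∘ suc))

  Σ-cong : ∀ {n} {f g : Vector n} → f ≐ g → Σ[ f ] ≡ Σ[ g ]
  Σ-cong {f = f} {g} f≐g = trans (Σ≡sum f) (trans (sum-cong-≗ f≐g) (sym (Σ≡sum g)))

  Σ-distrib-+ : ∀ {n} (f g : Vector n) → Σ[ (λ v → f v + g v) ] ≡ Σ[ f ] + Σ[ g ]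
  Σ-distrib-+ f g = begin
    Σ[ (λ v → f v + g v) ]  ≡⟨ Σ≡sum (λ v → f v + g v) ⟩
    sum (λ v → f v + g v)   ≡⟨ ∑-distrib-+ f g ⟩
    sum f + sum g           ≡⟨ cong₂ _+_ (Σ≡sum f) (Σ≡sum g) ⟨
    Σ[ f ] + Σ[ g ]         ∎
    where open ≡-Reasoning

  Σ-*ˡ : ∀ {n} a (f : Vector n) → Σ[ (λ v → a * f v) ] ≡ a * Σ[ f ]
  Σ-*ˡ a f = begin
    Σ[ (λ v → a * f v) ]  ≡⟨ Σ≡sum (λ v → a * f v) ⟩
    sum (λ v → a * f v)   ≡⟨ *-distribˡ-sum a f ⟨
    a * sum f             ≡⟨ cong (a *_) (Σ≡sum f) ⟨
    a * Σ[ f ]            ∎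
    where open ≡-Reasoning

  Σ-*ʳ : ∀ {n} a (f : Vector n) → Σ[ (λ v → f v * a) ] ≡ Σ[ f ] * a
  Σ-*ʳ a f = begin
    Σ[ (λ v → f v * a) ]  ≡⟨ Σ≡sum (λ v → f v * a) ⟩
    sum (λ v → f v * a)   ≡⟨ *-distribʳ-sum a f ⟨
    sum f * a             ≡⟨ cong (_* a) (Σ≡sum f) ⟨
    Σ[ f ] * a            ∎
    where open ≡-Reasoning

  Σ-comm : ∀ {m n} (h : Fin m → Fin n → Carrier) →
           Σ[ (λ u → Σ[ h u ]) ] ≡ Σ[ (λ v → Σ[ (λ u → h u v) ]) ]
  Σ-comm h = begin
    Σ[ (λ u → Σ[ h u ]) ]                ≡⟨ ΣΣ≡sumsum h ⟩
    sum (λ u → sum (h u))                ≡⟨ ∑-comm h ⟩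
    sum (λ v → sum (λ u → h u v))        ≡⟨ ΣΣ≡sumsum (λ v u → h u v) ⟨
    Σ[ (λ v → Σ[ (λ u → h u v) ]) ]      ∎
    where
    open ≡-Reasoning
    ΣΣ≡sumsum : ∀ {m n} (k : Fin m → Fin n → Carrier) → Σ[ (λ u → Σ[ k u ]) ] ≡ sum (λ u → sum (k u))
    ΣΣ≡sumsum k = trans (Σ-cong (λ u → Σ≡sum (k u))) (Σ≡sum (λ u → sum (k u)))

  Σ-distrib-- : ∀ {n} (f g : Vector n) → Σ[ (λ v → f v - g v) ] ≡ Σ[ f ] - Σ[ g ]
  Σ-distrib-- f g = trans (Σ-distrib-+ f (λ v → - g v)) (cong (Σ[ f ] +_) Σ-neg)
    where
    Σ-neg : Σ[ (λ v → - g v) ] ≡ - Σ[ g ]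
    Σ-neg = trans (Σ-cong (λ v → sym (-1*x≈-x (g v)))) (trans (Σ-*ˡ (- 1#) g) (-1*x≈-x Σ[ g ]))

  fromℕ-sumℕ : ∀ {n} (f : Fin n → ℕ) → fromℕ (sumℕ f) ≡ Σ[ fromℕ ∘ f ]
  fromℕ-sumℕ {ℕ.zero}  f = refl
  fromℕ-sumℕ {ℕ.suc n} f = trans (fromℕ-+ (f zero) _) (cong (fromℕ (f zero) +_) (fromℕ-sumℕ (f ∘ suc)))

  Σ-nonneg : ∀ {n} {f : Vector n} → (∀ v → 0# ≤ f v) → 0# ≤ Σ[ f ]
  Σ-nonneg {ℕ.zero}  f≥0 = ≤-refl
  Σ-nonneg {ℕ.suc n} f≥0 = +-nonneg (f≥0 zero) (Σ-nonneg (f≥0 ∘ suc))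

  f≤Σ : ∀ {n} {f : Vector n} → (∀ v → 0# ≤ f v) → ∀ v → f v ≤ Σ[ f ]
  f≤Σ f≥0 zero    = x≤x+y (Σ-nonneg (f≥0 ∘ suc))
  f≤Σ f≥0 (suc v) = ≤-trans (f≤Σ (f≥0 ∘ suc) v) (x≤y+x (f≥0 zero))

  nonneg∧Σ≡1⇒RankingVector : ∀ {n} {x : Vector n} → (∀ v → 0# ≤ x v) → Σ[ x ] ≡ 1# → RankingVector x
  nonneg∧Σ≡1⇒RankingVector x≥0 Σx≡1 = (λ v → x≥0 v , subst (_ ≤_) Σx≡1 (f≤Σ x≥0 v)) , Σx≡1

  Σ-·-stochastic : ∀ {n} (A : Fin n → Fin n → Carrier) → (∀ u → Σ[ A u ] ≡ 1#) →
                   ∀ x → Σ[ x · A ] ≡ Σ[ x ]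
  Σ-·-stochastic A rowSum x = begin
    Σ[ (λ v → Σ[ (λ u → x u * A u v) ]) ]  ≡⟨ Σ-comm (λ u v → x u * A u v) ⟨
    Σ[ (λ u → Σ[ (λ v → x u * A u v) ]) ]  ≡⟨ Σ-cong (λ u → Σ-*ˡ (x u) (A u)) ⟩
    Σ[ (λ u → x u * Σ[ A u ]) ]            ≡⟨ Σ-cong (λ u → trans (cong (x u *_) (rowSum u)) (*-identityʳ (x u))) ⟩
    Σ[ x ]                                 ∎
    where open ≡-Reasoning

  module _ {n} (E : Graph n) where

    M-rowSum : NoDangling E → ∀ u → Σ[ M E u ] ≡ 1#
    M-rowSum noDangling u = begin
      Σ[ M E u ]                      ≡⟨ Σ-cong (λ v → indicator (E u v)) ⟩
      Σ[ (λ v → d⁻¹ * fromℕ (𝟙 v)) ]  ≡⟨ Σ-*ˡ d⁻¹ (fromℕ ∘ 𝟙) ⟩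
      d⁻¹ * Σ[ fromℕ ∘ 𝟙 ]            ≡⟨ cong (d⁻¹ *_) (fromℕ-sumℕ 𝟙) ⟨
      d⁻¹ * fromℕ (outDeg E u)        ≡⟨ *-comm d⁻¹ _ ⟩
      fromℕ (outDeg E u) * d⁻¹        ≡⟨ ⁻¹-inverse _ (fromℕ≢0 (outDeg-pos noDangling u)) ⟩
      1#                              ∎
      where
      open ≡-Reasoning
      d⁻¹ = fromℕ (outDeg E u) ⁻¹
      𝟙 : Fin n → ℕ
      𝟙 v = if E u v then 1 else 0
      indicator : ∀ b → (if b then d⁻¹ else 0#) ≡ d⁻¹ * fromℕ (if b then 1 else 0)
      indicator true  = sym (trans (cong (d⁻¹ *_) (+-identityʳ 1#)) (*-identityʳ d⁻¹))
      indicator false = sym (zeroʳ d⁻¹)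

    inSum≐·M : ∀ p → inSum E p ≐ (p · M E)
    inSum≐·M p v = Σ-cong (λ w → if-*ʳ (E w v) (p w))
      where
      if-*ʳ : ∀ b x {d} → (if b then x * d else 0#) ≡ x * (if b then d else 0#)
      if-*ʳ true  x = refl
      if-*ʳ false x = sym (zeroʳ x)

    ·T : ∀ x r ε v → (x · T E r ε) v ≡ (1# - ε) * (x · M E) v + ε * r v * Σ[ x ]
    ·T x r ε v = begin
      Σ[ (λ u → x u * ((1# - ε) * M E u v + ε * r v)) ]
        ≡⟨ Σ-cong (λ u → trans (distribˡ (x u) _ _)
                               (cong₂ _+_ (x∙yz≈y∙xz (x u) (1# - ε) _) (*-comm (x u) _))) ⟩
      Σ[ (λ u → (1# - ε) * (x u * M E u v) + ε * r v * x u) ]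
        ≡⟨ Σ-distrib-+ (λ u → (1# - ε) * (x u * M E u v)) (λ u → ε * r v * x u) ⟩
      Σ[ (λ u → (1# - ε) * (x u * M E u v)) ] + Σ[ (λ u → ε * r v * x u) ]
        ≡⟨ cong₂ _+_ (Σ-*ˡ (1# - ε) (λ u → x u * M E u v)) (Σ-*ˡ (ε * r v) x) ⟩
      (1# - ε) * (x · M E) v + ε * r v * Σ[ x ]
        ∎
      where open ≡-Reasoning

    stationary⇔Rinv : ∀ {p r ε} → Σ[ p ] ≡ 1# → ε ≢ 0# → ((p · T E r ε) ≐ p) ⇔ (r ≐ Rinv E p ε)
    stationary⇔Rinv {p} {r} {ε} Σp≡1 ε≢0 =
      mk⇔ (λ stat v → Equivalence.to (solve v) (trans (sym (·T-ranking v)) (stat v)))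
          (λ r≐R v → trans (·T-ranking v) (Equivalence.from (solve v) (r≐R v)))
      where
      solve : ∀ v → ((1# - ε) * inSum E p v + ε * r v ≡ p v) ⇔ (r v ≡ Rinv E p ε v)
      solve v = +-*-isolateʳ (⁻¹-inverse ε ε≢0) (1# - ε) (inSum E p v) (r v) (p v)
      ·T-ranking : ∀ v → (p · T E r ε) v ≡ (1# - ε) * inSum E p v + ε * r v
      ·T-ranking v = trans (·T p r ε v)
        (cong₂ (λ q s → (1# - ε) * q + s) (sym (inSum≐·M p v))
               (trans (cong (ε * r v *_) Σp≡1) (*-identityʳ (ε * r v))))

    Σ-Rinv : NoDangling E → ∀ {p ε} → Σ[ p ] ≡ 1# → ε ≢ 0# → Σ[ Rinv E p ε ] ≡ 1#
    Σ-Rinv noDangling {p} {ε} Σp≡1 ε≢0 = begin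
      Σ[ Rinv E p ε ]                           ≡⟨ Σ-distrib-- (λ v → p v * ε ⁻¹) (λ v → a * inSum E p v) ⟩
      Σ[ (λ v → p v * ε ⁻¹) ] - Σ[ (λ v → a * inSum E p v) ]
                                                ≡⟨ cong₂ _-_ (Σ-*ʳ (ε ⁻¹) p) (Σ-*ˡ a (inSum E p)) ⟩
      Σ[ p ] * ε ⁻¹ - a * Σ[ inSum E p ]        ≡⟨ cong₂ (λ s t → s * ε ⁻¹ - a * t) Σp≡1 Σ-inSum ⟩
      1# * ε ⁻¹ - a * 1#                        ≡⟨ one-solves ⟨
      1#                                        ∎
      where
      open ≡-Reasoning
      a = (1# - ε) * ε ⁻¹
      one-solves : 1# ≡ 1# * ε ⁻¹ - a * 1#
      one-solves = Equivalence.to (+-*-isolateʳ (⁻¹-inverse ε ε≢0) (1# - ε) 1# 1# 1#) ([1-ε]x+εx≡x ε 1#)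
      Σ-inSum : Σ[ inSum E p ] ≡ 1#
      Σ-inSum = trans (Σ-cong (inSum≐·M p)) (trans (Σ-·-stochastic (M E) (M-rowSum noDangling) p) Σp≡1)

    Rinv-fixed : ∀ {p ε} → (p · M E) ≐ p → ε ≢ 0# → Rinv E p ε ≐ p
    Rinv-fixed {p} {ε} pM≐p ε≢0 v =
      sym (Equivalence.to (+-*-isolateʳ (⁻¹-inverse ε ε≢0) (1# - ε) (inSum E p v) (p v) (p v)) p-solves)
      where
      p-solves : (1# - ε) * inSum E p v + ε * p v ≡ p v
      p-solves = trans (cong (λ q → (1# - ε) * q + ε * p v) (trans (inSum≐·M p v) (pM≐p v)))
                       ([1-ε]x+εx≡x ε (p v))

    InUnit⇒≢0 : ∀ {ε} → InUnit ε → ε ≢ 0#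
    InUnit⇒≢0 ((_ , 0≢ε) , _) = 0≢ε ∘ sym

    InX⇔Rinv : NoDangling E → ∀ {p} → RankingVector p → ∀ r ε →
               InX E p r ε ⇔ (InUnit ε × (r ≐ Rinv E p ε) × (∀ v → 0# ≤ Rinv E p ε v))
    InX⇔Rinv noDangling {p} p-ranking@(_ , Σp≡1) r ε = mk⇔ to from
      where
      to : InX E p r ε → InUnit ε × (r ≐ Rinv E p ε) × (∀ v → 0# ≤ Rinv E p ε v)
      to ((r∈[0,1] , _) , ε∈I , _ , stat) = ε∈I , r≐R , λ v → subst (0# ≤_) (r≐R v) (proj₁ (r∈[0,1] v))
        where
        r≐R : r ≐ Rinv E p ε
        r≐R = Equivalence.to (stationary⇔Rinv Σp≡1 (InUnit⇒≢0 ε∈I)) stat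
      from : InUnit ε × (r ≐ Rinv E p ε) × (∀ v → 0# ≤ Rinv E p ε v) → InX E p r ε
      from (ε∈I , r≐R , R≥0) =
        nonneg∧Σ≡1⇒RankingVector (λ v → subst (0# ≤_) (sym (r≐R v)) (R≥0 v))
                                 (trans (Σ-cong r≐R) (Σ-Rinv noDangling Σp≡1 ε≢0)) ,
        ε∈I , p-ranking , Equivalence.from (stationary⇔Rinv Σp≡1 ε≢0) r≐R
        where
        ε≢0 = InUnit⇒≢0 ε∈I

    InX⇔fixed : NoDangling E → ∀ {p} → RankingVector p → (p · M E) ≐ p → ∀ r ε →
                InX E p r ε ⇔ ((r ≐ p) × InUnit ε)
    InX⇔fixed noDangling {p} p-ranking@(p∈[0,1] , _) pM≐p r ε = mk⇔ to from
      where
      open Equivalence (InX⇔Rinv noDangling p-ranking r ε) renaming (to to toRinv; from to fromRinv)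
      to : InX E p r ε → (r ≐ p) × InUnit ε
      to x with toRinv x
      ... | ε∈I , r≐R , _ = (λ v → trans (r≐R v) (Rinv-fixed pM≐p (InUnit⇒≢0 ε∈I) v)) , ε∈I
      from : (r ≐ p) × InUnit ε → InX E p r ε
      from (r≐p , ε∈I) = fromRinv (ε∈I , (λ v → trans (r≐p v) (sym (R≐p v))) ,
                                       λ v → subst (0# ≤_) (sym (R≐p v)) (proj₁ (p∈[0,1] v)))
        where
        R≐p = Rinv-fixed pM≐p (InUnit⇒≢0 ε∈I)

theorem17 : ∀ {c ℓ} (F : OrderedField c ℓ) (n : ℕ) (E : Graph n) →
    NoDangling E →
    let open OrderedField F
        open WithField F
    in (p : Vector n) → InP E p →
       (((p · M E) ≐ p) →
          ∀ (r : Vector n) (ε : Carrier) → InX E p r ε ⇔ ((r ≐ p) × InUnit ε))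
       ×
       (¬ ((p · M E) ≐ p) →
          ∀ (r : Vector n) (ε : Carrier) →
            InX E p r ε ⇔ (InUnit ε × (r ≐ Rinv E p ε) × (∀ v → 0# ≤ Rinv E p ε v)))
theorem17 F n E noDangling p (_ , _ , _ , _ , p-ranking , _) =
  InX⇔fixed E noDangling p-ranking ,
  -- the description through 𝓡⁻¹ holds whether or not p M = p
  λ _ → InX⇔Rinv E noDangling p-ranking
  where open Properties F
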